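{- Let $n$ be an odd positive integer and let $v_1,\ldots,v_n \in \mathbb{Z}^n$ be an orthoregular system. Then the length of the system is an integer.
   Context: A system $v_1,\ldots,v_k$ of vectors in $\mathbb{R}^n$ is called orthoregular if (i) $v_i$ and $v_j$ are perpendicular (for the standard inner product) whenever $i\neq j$, and (ii) $|v_i|=|v_j|\neq 0$ for all $i,j$, where $|\cdot|$ is the Euclidean norm. The common value $|v_i|$ is called the length of the system. -}

module Defs where

open import Data.Nat using (ℕ; zero; suc)
open import Data.Fin using (Fin; zero; suc)
open import Data.Integer using (ℤ; _+_; _*_; 0ℤ)
open import Data.Product using (_×_)
open import Relation.Binary.PropositionalEquality using (_≡_; _≢_)

ℤVec : ℕ → Set
ℤVec n = Fin n → ℤ

dot : ∀ {n} → ℤVec n → ℤVec n → ℤ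
dot {zero}  u w = 0ℤ
dot {suc n} u w = u zero * w zero + dot {n} (λ i → u (suc i)) (λ i → w (suc i))

normSq : ∀ {n} → ℤVec n → ℤ
normSq u = dot u u

-- A system v_1,...,v_k of vectors in ℤ^n is orthoregular if the vectors are
-- pairwise perpendicular and all have the same nonzero length.
-- (Equal lengths ⇔ equal squared lengths; nonzero length ⇔ nonzero squared length.)
Orthoregular : ∀ {k n} → (Fin k → ℤVec n) → Set
Orthoregular {k} v =
  (∀ (i j : Fin k) → i ≢ j → dot (v i) (v j) ≡ 0ℤ)
  × (∀ (i j : Fin k) → normSq (v i) ≡ normSq (v j))
  × (∀ (i : Fin k) → normSq (v i) ≢ 0ℤ)

module Submission where

-- Let V be the matrix whose rows are the v_i and L = |v_i|². Orthoregularity says V Vᵀ = L·I,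
-- so d = |det V| satisfies d² = det(V) det(Vᵀ) = det(V Vᵀ) = Lⁿ. For odd n = 2k + 1 this reads
-- d² = L·(Lᵏ)², hence Lᵏ divides d and L = (d / Lᵏ)² is the square of an integer.
-- The determinant identities come from the Leibniz formula: multiplicativity rests on
-- det(A ∘ τ) = ε(τ) det(A) for every map τ of the row indices, shown by bubble sort.

open import Defs

module Determinants where

  open import Data.Nat as ℕ using (ℕ; zero; suc; z≤n; s≤s)
  import Data.Nat.Properties as ℕₚ
  open import Data.Nat.Tactic.RingSolver using () renaming (solve-∀ to ℕ-solve)
  open import Data.Fin using (Fin; zero; suc; inject₁; toℕ; fromℕ; _<_)
  open import Data.Fin.Properties as Finₚ using (toℕ-injective; toℕ-fromℕ; toℕ≤pred[n])
  open import Data.Fin.Permutation using (Permutation′; permutation)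
  open import Data.Vec.Functional using ([]; _∷_)
  open import Data.Integer
    using (ℤ; _+_; _*_; -_; _^_; 0ℤ; 1ℤ; -1ℤ; +0; +[1+_]; -[1+_]; _≤_; +≤+; ∣_∣; nonNegative; ≢-nonZero)
  open import Data.Integer.Properties
  open import Data.Integer.Tactic.RingSolver using (solve-∀)
  open import Algebra.Properties.CommutativeSemigroup *-commutativeSemigroup using (x∙yz≈y∙xz)
  open import Algebra.Properties.Semiring.Sum +-*-semiring
    using (sum; sum-cong-≗; sum-replicate-zero; ∑-comm; *-distribˡ-sum)
  open import Algebra.Properties.CommutativeMonoid.Sum *-1-commutativeMonoid
    using () renaming (sum to ∏; sum-cong-≗ to ∏-cong; ∑-distrib-+ to ∏-distrib-*; sum-permute to ∏-permute)
  open import Algebra.Properties.CommutativeMonoid.Sum ℕₚ.+-0-commutativeMonoid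
    using () renaming (sum to sumℕ; sum-permute to sumℕ-permute)
  open import Data.Product using (∃; _,_)
  open import Data.Sum using (_⊎_; inj₁; inj₂)
  open import Function using (_∘_; id)
  open import Data.Empty using (⊥-elim)
  open import Relation.Nullary using (yes; no)
  open import Induction.WellFounded using (Acc; acc)
  open import Data.Nat.Induction using (<-wellFounded)
  open import Relation.Binary.Definitions using (tri<; tri≈; tri>)
  open import Relation.Binary.PropositionalEquality
  open ≡-Reasoning

  private
    variable
      m n : ℕ
      X : Set

  adjacentSwap : Fin n → Fin (suc n) → Fin (suc n)
  adjacentSwap zero    zero          = suc zero
  adjacentSwap zero    (suc zero)    = zero
  adjacentSwap zero    (suc (suc k)) = suc (suc k)
  adjacentSwap (suc i) zero          = zero
  adjacentSwap (suc i) (suc k)       = suc (adjacentSwap i k)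

  adjacentSwap-involutive : (i : Fin n) (k : Fin (suc n)) → adjacentSwap i (adjacentSwap i k) ≡ k
  adjacentSwap-involutive zero    zero          = refl
  adjacentSwap-involutive zero    (suc zero)    = refl
  adjacentSwap-involutive zero    (suc (suc k)) = refl
  adjacentSwap-involutive (suc i) zero          = refl
  adjacentSwap-involutive (suc i) (suc k)       = cong suc (adjacentSwap-involutive i k)

  adjacentSwapᵖ : Fin n → Permutation′ (suc n)
  adjacentSwapᵖ i = permutation (adjacentSwap i) (adjacentSwap i)
    (adjacentSwap-involutive i) (adjacentSwap-involutive i)

  ∘-adjacentSwap-≗ : (f : Fin (suc n) → X) (i : Fin n) → f (inject₁ i) ≡ f (suc i) →
                     f ∘ adjacentSwap i ≗ f
  ∘-adjacentSwap-≗ f zero    tie zero          = sym tie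
  ∘-adjacentSwap-≗ f zero    tie (suc zero)    = tie
  ∘-adjacentSwap-≗ f zero    tie (suc (suc k)) = refl
  ∘-adjacentSwap-≗ f (suc i) tie zero          = refl
  ∘-adjacentSwap-≗ f (suc i) tie (suc k)       = ∘-adjacentSwap-≗ (f ∘ suc) i tie k

  ∏-∘-adjacentSwap : (f : Fin (suc n) → ℤ) (i : Fin n) → ∏ (f ∘ adjacentSwap i) ≡ ∏ f
  ∏-∘-adjacentSwap f i = sym (∏-permute f (adjacentSwapᵖ i))

  sumℕ-∘-adjacentSwap : (f : Fin (suc n) → ℕ) (i : Fin n) → sumℕ (f ∘ adjacentSwap i) ≡ sumℕ f
  sumℕ-∘-adjacentSwap f i = sym (sumℕ-permute f (adjacentSwapᵖ i))

  sumMaps : ((Fin n → Fin m) → ℤ) → ℤ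
  sumMaps {zero}  g = g []
  sumMaps {suc n} g = sum (λ a → sumMaps (λ σ → g (a ∷ σ)))

  -- Without function extensionality, reindexing a sum over maps needs the summand to respect _≗_.
  Congruent : ((Fin n → Fin m) → ℤ) → Set
  Congruent g = ∀ {σ τ} → σ ≗ τ → g σ ≡ g τ

  congruent-∷ : {g : (Fin (suc n) → Fin m) → ℤ} → Congruent g → ∀ a → Congruent (λ σ → g (a ∷ σ))
  congruent-∷ g-cong a σ≗τ = g-cong λ { zero → refl ; (suc k) → σ≗τ k }

  η-∷ : (τ : Fin (suc n) → X) → τ ≗ τ zero ∷ τ ∘ suc
  η-∷ τ zero    = refl
  η-∷ τ (suc k) = refl

  sumMaps-cong : {g h : (Fin n → Fin m) → ℤ} → g ≗ h → sumMaps g ≡ sumMaps h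
  sumMaps-cong {zero}  g≗h = g≗h []
  sumMaps-cong {suc n} g≗h = sum-cong-≗ (λ a → sumMaps-cong (λ σ → g≗h (a ∷ σ)))

  *-distribˡ-sumMaps : ∀ c (g : (Fin n → Fin m) → ℤ) → c * sumMaps g ≡ sumMaps (λ σ → c * g σ)
  *-distribˡ-sumMaps {zero}  c g = refl
  *-distribˡ-sumMaps {suc n} c g = trans (*-distribˡ-sum c (λ a → sumMaps (λ σ → g (a ∷ σ))))
    (sum-cong-≗ (λ a → *-distribˡ-sumMaps c (λ σ → g (a ∷ σ))))

  neg-distrib-sumMaps : (g : (Fin n → Fin m) → ℤ) → sumMaps (λ σ → - g σ) ≡ - sumMaps g
  neg-distrib-sumMaps g = begin
    sumMaps (λ σ → - g σ)       ≡⟨ sumMaps-cong (λ σ → sym (-1*i≡-i (g σ))) ⟩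
    sumMaps (λ σ → -1ℤ * g σ)   ≡⟨ *-distribˡ-sumMaps -1ℤ g ⟨
    -1ℤ * sumMaps g             ≡⟨ -1*i≡-i (sumMaps g) ⟩
    - sumMaps g                 ∎

  sum-sumMaps-comm : ∀ {k} (g : Fin k → (Fin n → Fin m) → ℤ) →
                     sum (λ j → sumMaps (g j)) ≡ sumMaps (λ σ → sum (λ j → g j σ))
  sum-sumMaps-comm {n = zero}  g = refl
  sum-sumMaps-comm {n = suc n} g = trans (∑-comm (λ j a → sumMaps (λ σ → g j (a ∷ σ))))
    (sum-cong-≗ (λ a → sum-sumMaps-comm (λ j σ → g j (a ∷ σ))))

  sumMaps-comm : ∀ {n′ m′} (g : (Fin n → Fin m) → (Fin n′ → Fin m′) → ℤ) →
                 sumMaps (λ σ → sumMaps (g σ)) ≡ sumMaps (λ τ → sumMaps (λ σ → g σ τ))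
  sumMaps-comm {zero}  g = refl
  sumMaps-comm {suc n} g = trans (sum-cong-≗ (λ a → sumMaps-comm (λ σ → g (a ∷ σ))))
    (sum-sumMaps-comm (λ a τ → sumMaps (λ σ → g (a ∷ σ) τ)))

  ∏-sum≡sumMaps-∏ : (f : Fin n → Fin m → ℤ) → ∏ (λ i → sum (f i)) ≡ sumMaps (λ τ → ∏ (λ i → f i (τ i)))
  ∏-sum≡sumMaps-∏ {zero}  f = refl
  ∏-sum≡sumMaps-∏ {suc n} f = begin
    sum (f zero) * ∏ (λ i → sum (f (suc i)))
      ≡⟨ cong (sum (f zero) *_) (∏-sum≡sumMaps-∏ (f ∘ suc)) ⟩
    sum (f zero) * sumMaps rest
      ≡⟨ *-comm (sum (f zero)) _ ⟩
    sumMaps rest * sum (f zero)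
      ≡⟨ *-distribˡ-sum (sumMaps rest) (f zero) ⟩
    sum (λ a → sumMaps rest * f zero a)
      ≡⟨ sum-cong-≗ (λ a → trans (*-comm _ (f zero a)) (*-distribˡ-sumMaps (f zero a) rest)) ⟩
    sum (λ a → sumMaps (λ τ → f zero a * rest τ)) ∎
    where
    rest : (Fin n → Fin _) → ℤ
    rest τ = ∏ (λ i → f (suc i) (τ i))

  sumMaps-∘-adjacentSwap : (g : (Fin (suc n) → Fin m) → ℤ) → Congruent g → (i : Fin n) →
                           sumMaps (λ σ → g (σ ∘ adjacentSwap i)) ≡ sumMaps g
  sumMaps-∘-adjacentSwap {suc n} g g-cong zero = begin
    sum (λ a → sum (λ b → sumMaps (λ ρ → g ((a ∷ b ∷ ρ) ∘ adjacentSwap zero))))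
      ≡⟨ sum-cong-≗ (λ a → sum-cong-≗ (λ b → sumMaps-cong (λ ρ → g-cong (swapped a b ρ)))) ⟩
    sum (λ a → sum (λ b → sumMaps (λ ρ → g (b ∷ a ∷ ρ))))
      ≡⟨ ∑-comm (λ a b → sumMaps (λ ρ → g (b ∷ a ∷ ρ))) ⟩
    sum (λ b → sum (λ a → sumMaps (λ ρ → g (b ∷ a ∷ ρ))))    ∎
    where
    swapped : ∀ a b ρ → (a ∷ b ∷ ρ) ∘ adjacentSwap zero ≗ b ∷ a ∷ ρ
    swapped a b ρ zero          = refl
    swapped a b ρ (suc zero)    = refl
    swapped a b ρ (suc (suc k)) = refl
  sumMaps-∘-adjacentSwap g g-cong (suc i) = sum-cong-≗ (λ a → begin
    sumMaps (λ σ → g ((a ∷ σ) ∘ adjacentSwap (suc i)))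
      ≡⟨ sumMaps-cong (λ σ → g-cong (shifted a σ)) ⟩
    sumMaps (λ σ → g (a ∷ σ ∘ adjacentSwap i))
      ≡⟨ sumMaps-∘-adjacentSwap (λ σ → g (a ∷ σ)) (congruent-∷ g-cong a) i ⟩
    sumMaps (λ σ → g (a ∷ σ))                                ∎)
    where
    shifted : ∀ a σ → (a ∷ σ) ∘ adjacentSwap (suc i) ≗ a ∷ σ ∘ adjacentSwap i
    shifted a σ zero    = refl
    shifted a σ (suc k) = refl

  square-nonneg : ∀ x → 0ℤ ≤ x * x
  square-nonneg +0        = +≤+ z≤n
  square-nonneg +[1+ k ]  = +≤+ z≤n
  square-nonneg -[1+ k ]  = +≤+ z≤n

  sum-nonneg : (f : Fin n → ℤ) → (∀ i → 0ℤ ≤ f i) → 0ℤ ≤ sum f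
  sum-nonneg {zero}  f f≥0 = ≤-refl
  sum-nonneg {suc n} f f≥0 = +-mono-≤ (f≥0 zero) (sum-nonneg (f ∘ suc) (f≥0 ∘ suc))

  term≤sum : (f : Fin n → ℤ) → (∀ i → 0ℤ ≤ f i) → ∀ i → f i ≤ sum f
  term≤sum f f≥0 zero    = i≤i+j (f zero) _ ⦃ nonNegative (sum-nonneg (f ∘ suc) (f≥0 ∘ suc)) ⦄
  term≤sum f f≥0 (suc i) = i≤j⇒i≤k+j (f zero) ⦃ nonNegative (f≥0 zero) ⦄ (term≤sum (f ∘ suc) (f≥0 ∘ suc) i)

  sumMaps-nonneg : (g : (Fin n → Fin m) → ℤ) → (∀ σ → 0ℤ ≤ g σ) → 0ℤ ≤ sumMaps g
  sumMaps-nonneg {zero}  g g≥0 = g≥0 []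
  sumMaps-nonneg {suc n} g g≥0 = sum-nonneg _ (λ a → sumMaps-nonneg (λ σ → g (a ∷ σ)) (λ σ → g≥0 (a ∷ σ)))

  term≤sumMaps : (g : (Fin n → Fin m) → ℤ) → Congruent g → (∀ σ → 0ℤ ≤ g σ) → ∀ τ → g τ ≤ sumMaps g
  term≤sumMaps {zero}  g g-cong g≥0 τ = ≤-reflexive (g-cong λ ())
  term≤sumMaps {suc n} g g-cong g≥0 τ = ≤-trans (≤-reflexive (g-cong (η-∷ τ)))
    (≤-trans (term≤sumMaps (λ σ → g (τ zero ∷ σ)) (congruent-∷ g-cong (τ zero)) (λ σ → g≥0 _) (τ ∘ suc))
             (term≤sum _ (λ a → sumMaps-nonneg _ (λ σ → g≥0 (a ∷ σ))) (τ zero)))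

  δ : Fin n → Fin n → ℤ
  δ zero    zero    = 1ℤ
  δ zero    (suc _) = 0ℤ
  δ (suc _) zero    = 0ℤ
  δ (suc a) (suc b) = δ a b

  δ-refl : (a : Fin n) → δ a a ≡ 1ℤ
  δ-refl zero    = refl
  δ-refl (suc a) = δ-refl a

  δ-≢ : (a b : Fin n) → a ≢ b → δ a b ≡ 0ℤ
  δ-≢ zero    zero    a≢b = ⊥-elim (a≢b refl)
  δ-≢ zero    (suc b) a≢b = refl
  δ-≢ (suc a) zero    a≢b = refl
  δ-≢ (suc a) (suc b) a≢b = δ-≢ a b (a≢b ∘ cong suc)

  sum-δ : (a : Fin n) (f : Fin n → ℤ) → sum (λ b → δ a b * f b) ≡ f a
  sum-δ (zero {n}) f = begin
    1ℤ * f zero + sum (λ b → 0ℤ * f (suc b))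
      ≡⟨ cong₂ _+_ (*-identityˡ (f zero)) (sum-cong-≗ (λ b → *-zeroˡ (f (suc b)))) ⟩
    f zero + sum {n} (λ _ → 0ℤ)
      ≡⟨ cong (f zero +_) (sum-replicate-zero n) ⟩
    f zero + 0ℤ
      ≡⟨ +-identityʳ (f zero) ⟩
    f zero ∎
  sum-δ (suc a) f = trans (cong (_+ sum (λ b → δ a b * f (suc b))) (*-zeroˡ (f zero)))
                          (trans (+-identityˡ _) (sum-δ a (f ∘ suc)))

  sumMaps-δ : (g : (Fin n → Fin m) → ℤ) → Congruent g → (τ : Fin n → Fin m) →
              sumMaps (λ σ → g σ * ∏ (λ i → δ (τ i) (σ i))) ≡ g τ
  sumMaps-δ {zero}  g g-cong τ = trans (*-identityʳ _) (g-cong λ ())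
  sumMaps-δ {suc n} g g-cong τ = begin
    sum (λ a → sumMaps (λ σ → g (a ∷ σ) * (δ (τ zero) a * ∏δ σ)))
      ≡⟨ sum-cong-≗ (λ a → trans (sumMaps-cong (λ σ → x∙yz≈y∙xz (g (a ∷ σ)) (δ (τ zero) a) (∏δ σ)))
                                 (sym (*-distribˡ-sumMaps (δ (τ zero) a) (λ σ → g (a ∷ σ) * ∏δ σ)))) ⟩
    sum (λ a → δ (τ zero) a * sumMaps (λ σ → g (a ∷ σ) * ∏δ σ))
      ≡⟨ sum-cong-≗ (λ a → cong (δ (τ zero) a *_) (sumMaps-δ _ (congruent-∷ g-cong a) (τ ∘ suc))) ⟩
    sum (λ a → δ (τ zero) a * g (a ∷ τ ∘ suc))
      ≡⟨ sum-δ (τ zero) (λ a → g (a ∷ τ ∘ suc)) ⟩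
    g (τ zero ∷ τ ∘ suc)
      ≡⟨ g-cong (η-∷ τ) ⟨
    g τ ∎
    where
    ∏δ : (Fin n → Fin _) → ℤ
    ∏δ σ = ∏ (λ i → δ (τ (suc i)) (σ i))

  -- ε τ = ∏_{i<j} sgn (τ j − τ i) is the sign of τ when τ is a bijection and 0 otherwise, so the
  -- Leibniz formula below may sum over all maps instead of over permutations.
  sgn : Fin m → Fin m → ℤ
  sgn zero    zero    = 0ℤ
  sgn zero    (suc _) = 1ℤ
  sgn (suc _) zero    = -1ℤ
  sgn (suc a) (suc b) = sgn a b

  sgn-antisym : (a b : Fin m) → sgn b a ≡ - sgn a b
  sgn-antisym zero    zero    = refl
  sgn-antisym zero    (suc b) = refl
  sgn-antisym (suc a) zero    = refl
  sgn-antisym (suc a) (suc b) = sgn-antisym a b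

  ε : (Fin n → Fin m) → ℤ
  ε {zero}  τ = 1ℤ
  ε {suc n} τ = ∏ (λ j → sgn (τ zero) (τ (suc j))) * ε (τ ∘ suc)

  ε-cong : {σ τ : Fin n → Fin m} → σ ≗ τ → ε σ ≡ ε τ
  ε-cong {zero}  σ≗τ = refl
  ε-cong {suc n} σ≗τ = cong₂ _*_ (∏-cong (λ j → cong₂ sgn (σ≗τ zero) (σ≗τ (suc j)))) (ε-cong (σ≗τ ∘ suc))

  ε-∘-adjacentSwap : (τ : Fin (suc n) → Fin m) (i : Fin n) → ε (τ ∘ adjacentSwap i) ≡ - ε τ
  ε-∘-adjacentSwap {suc n} τ zero = begin
    (sgn τ₁ τ₀ * P₁) * (P₀ * E)     ≡⟨ cong (λ s → (s * P₁) * (P₀ * E)) (sgn-antisym τ₀ τ₁) ⟩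
    (- sgn τ₀ τ₁ * P₁) * (P₀ * E)   ≡⟨ swap-factors (sgn τ₀ τ₁) P₀ P₁ E ⟩
    - ((sgn τ₀ τ₁ * P₀) * (P₁ * E)) ∎
    where
    τ₀ = τ zero
    τ₁ = τ (suc zero)
    P₀ = ∏ {n} (λ k → sgn τ₀ (τ (suc (suc k))))
    P₁ = ∏ {n} (λ k → sgn τ₁ (τ (suc (suc k))))
    E = ε {n} (λ k → τ (suc (suc k)))
    swap-factors : ∀ s p q e → (- s * q) * (p * e) ≡ - ((s * p) * (q * e))
    swap-factors = solve-∀
  ε-∘-adjacentSwap τ (suc i) = begin
    ∏ (λ j → sgn (τ zero) (τ (suc (adjacentSwap i j)))) * ε (τ ∘ suc ∘ adjacentSwap i)
      ≡⟨ cong₂ _*_ (∏-∘-adjacentSwap (λ j → sgn (τ zero) (τ (suc j))) i) (ε-∘-adjacentSwap (τ ∘ suc) i) ⟩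
    ∏ (λ j → sgn (τ zero) (τ (suc j))) * - ε (τ ∘ suc)
      ≡⟨ neg-distribʳ-* (∏ (λ j → sgn (τ zero) (τ (suc j)))) (ε (τ ∘ suc)) ⟨
    - ε τ ∎

  self-negating⇒0 : ∀ {x} → x ≡ - x → x ≡ 0ℤ
  self-negating⇒0 {+0}       _  = refl
  self-negating⇒0 {+[1+ _ ]} ()
  self-negating⇒0 { -[1+ _ ]} ()

  ε-tie : (τ : Fin (suc n) → Fin m) (i : Fin n) → τ (inject₁ i) ≡ τ (suc i) → ε τ ≡ 0ℤ
  ε-tie τ i tie = self-negating⇒0 (trans (sym (ε-cong (∘-adjacentSwap-≗ τ i tie))) (ε-∘-adjacentSwap τ i))

  ∏-const : ∀ n (c : ℤ) → ∏ {n} (λ _ → c) ≡ c ^ n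
  ∏-const zero    c = refl
  ∏-const (suc n) c = cong (c *_) (∏-const n c)

  ε-suc∘ : (τ : Fin n → Fin m) → ε (λ i → suc (τ i)) ≡ ε τ
  ε-suc∘ {zero}  τ = refl
  ε-suc∘ {suc n} τ = cong (∏ (λ j → sgn (τ zero) (τ (suc j))) *_) (ε-suc∘ (τ ∘ suc))

  ε-id : ε {n} id ≡ 1ℤ
  ε-id {zero}  = refl
  ε-id {suc n} = begin
    ∏ {n} (λ _ → 1ℤ) * ε {n} suc   ≡⟨ cong₂ _*_ (trans (∏-const n 1ℤ) (^-zeroˡ n)) (ε-suc∘ {n} id) ⟩
    1ℤ * ε {n} id                   ≡⟨ *-identityˡ _ ⟩
    ε {n} id                        ≡⟨ ε-id {n} ⟩
    1ℤ                              ∎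

  -- Leibniz determinants

  Matrix : ℕ → Set
  Matrix n = Fin n → Fin n → ℤ

  leibnizTerm : Matrix n → (Fin n → Fin n) → ℤ
  leibnizTerm A σ = ε σ * ∏ (λ i → A i (σ i))

  det : Matrix n → ℤ
  det A = sumMaps (leibnizTerm A)

  leibnizTerm-congruent : (A : Matrix n) → Congruent (leibnizTerm A)
  leibnizTerm-congruent A σ≗τ = cong₂ _*_ (ε-cong σ≗τ) (∏-cong (λ i → cong (A i) (σ≗τ i)))

  det-cong : {A B : Matrix n} → (∀ i j → A i j ≡ B i j) → det A ≡ det B
  det-cong A≗B = sumMaps-cong (λ σ → cong (ε σ *_) (∏-cong (λ i → A≗B i (σ i))))

  det-∘-adjacentSwap : (A : Matrix (suc n)) (i : Fin n) → det (A ∘ adjacentSwap i) ≡ - det A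
  det-∘-adjacentSwap A i = begin
    det (A ∘ adjacentSwap i)
      ≡⟨ sumMaps-∘-adjacentSwap (leibnizTerm A∘swap) (leibnizTerm-congruent A∘swap) i ⟨
    sumMaps (λ σ → ε (σ ∘ adjacentSwap i) * ∏ (λ k → A (adjacentSwap i k) (σ (adjacentSwap i k))))
      ≡⟨ sumMaps-cong (λ σ → cong₂ _*_ (ε-∘-adjacentSwap σ i) (∏-∘-adjacentSwap (λ k → A k (σ k)) i)) ⟩
    sumMaps (λ σ → - ε σ * ∏ (λ k → A k (σ k)))
      ≡⟨ sumMaps-cong (λ σ → sym (neg-distribˡ-* (ε σ) (∏ (λ k → A k (σ k))))) ⟩
    sumMaps (λ σ → - leibnizTerm A σ)
      ≡⟨ neg-distrib-sumMaps (leibnizTerm A) ⟩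
    - det A ∎
    where
    A∘swap = A ∘ adjacentSwap i

  det-tie : (A : Matrix (suc n)) (i : Fin n) → (∀ j → A (inject₁ i) j ≡ A (suc i) j) → det A ≡ 0ℤ
  det-tie A i tie = self-negating⇒0 (trans (det-cong rows) (det-∘-adjacentSwap A i))
    where
    rows : ∀ k j → A k j ≡ A (adjacentSwap i k) j
    rows k j = sym (∘-adjacentSwap-≗ (λ k → A k j) i (tie j) k)

  Ascending : (Fin (suc n) → ℕ) → Set
  Ascending {n} f = (i : Fin n) → f (inject₁ i) ℕ.< f (suc i)

  ascending⇒head+toℕ≤ : (f : Fin (suc n) → ℕ) → Ascending f → ∀ j → f zero ℕ.+ toℕ j ℕ.≤ f j
  ascending⇒head+toℕ≤ f asc zero = ℕₚ.≤-reflexive (ℕₚ.+-identityʳ (f zero))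
  ascending⇒head+toℕ≤ {suc n} f asc (suc j) = ℕₚ.≤-trans
    (ℕₚ.≤-reflexive (ℕₚ.+-suc (f zero) (toℕ j)))
    (ℕₚ.≤-trans (ℕₚ.+-monoˡ-≤ (toℕ j) (asc zero)) (ascending⇒head+toℕ≤ (f ∘ suc) (asc ∘ suc) j))

  ascending-bounded⇒head≤ : ∀ c (f : Fin (suc n) → ℕ) → Ascending f → (∀ j → f j ℕ.≤ c ℕ.+ n) → f zero ℕ.≤ c
  ascending-bounded⇒head≤ {n} c f asc f≤c+n = ℕₚ.+-cancelʳ-≤ n (f zero) c (ℕₚ.≤-trans
    (subst (λ k → f zero ℕ.+ k ℕ.≤ f (fromℕ n)) (toℕ-fromℕ n) (ascending⇒head+toℕ≤ f asc (fromℕ n)))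
    (f≤c+n (fromℕ n)))

  ascending-within⇒≡+toℕ : ∀ c (f : Fin (suc n) → ℕ) → Ascending f →
                          c ℕ.≤ f zero → (∀ j → f j ℕ.≤ c ℕ.+ n) → ∀ j → f j ≡ c ℕ.+ toℕ j
  ascending-within⇒≡+toℕ c f asc c≤f₀ f≤c+n zero =
    trans (ℕₚ.≤-antisym (ascending-bounded⇒head≤ c f asc f≤c+n) c≤f₀) (sym (ℕₚ.+-identityʳ c))
  ascending-within⇒≡+toℕ {suc n} c f asc c≤f₀ f≤c+n (suc j) =
    trans (ascending-within⇒≡+toℕ (suc c) (f ∘ suc) (asc ∘ suc) suc-c≤f₁ f∘suc≤ j) (sym (ℕₚ.+-suc c (toℕ j)))
    where
    suc-c≤f₁ : suc c ℕ.≤ f (suc zero)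
    suc-c≤f₁ = ℕₚ.≤-trans (s≤s c≤f₀) (asc zero)
    f∘suc≤ : ∀ k → f (suc k) ℕ.≤ suc c ℕ.+ n
    f∘suc≤ k = subst (f (suc k) ℕ.≤_) (ℕₚ.+-suc c n) (f≤c+n (suc k))

  ascending⇒≗id : (τ : Fin (suc n) → Fin (suc n)) → Ascending (toℕ ∘ τ) → τ ≗ id
  ascending⇒≗id τ asc j = toℕ-injective (ascending-within⇒≡+toℕ 0 (toℕ ∘ τ) asc z≤n (toℕ≤pred[n] ∘ τ) j)

  adjacent-trichotomy : (τ : Fin (suc n) → Fin m) →
    (∃ λ i → τ (suc i) < τ (inject₁ i)) ⊎ (∃ λ i → τ (inject₁ i) ≡ τ (suc i)) ⊎ Ascending (toℕ ∘ τ)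
  adjacent-trichotomy {zero}  τ = inj₂ (inj₂ λ ())
  adjacent-trichotomy {suc n} τ with Finₚ.<-cmp (τ zero) (τ (suc zero))
  ... | tri> _ _ desc = inj₁ (zero , desc)
  ... | tri≈ _ tie _  = inj₂ (inj₁ (zero , tie))
  ... | tri< asc _ _ with adjacent-trichotomy (τ ∘ suc)
  ...   | inj₁ (i , desc)       = inj₁ (suc i , desc)
  ...   | inj₂ (inj₁ (i , tie)) = inj₂ (inj₁ (suc i , tie))
  ...   | inj₂ (inj₂ asc′)      = inj₂ (inj₂ λ { zero → asc ; (suc i) → asc′ i })

  inverted : Fin m → Fin m → ℕ
  inverted zero    _       = 0
  inverted (suc a) zero    = 1
  inverted (suc a) (suc b) = inverted a b

  inverted-> : {a b : Fin m} → b < a → inverted a b ≡ 1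
  inverted-> {a = suc a} {zero}  _         = refl
  inverted-> {a = suc a} {suc b} (s≤s b<a) = inverted-> b<a

  inverted-< : {a b : Fin m} → a < b → inverted a b ≡ 0
  inverted-< {a = zero}  _         = refl
  inverted-< {a = suc a} {suc b} (s≤s a<b) = inverted-< a<b

  inversions : (Fin n → Fin m) → ℕ
  inversions {zero}  τ = 0
  inversions {suc n} τ = sumℕ (λ j → inverted (τ zero) (τ (suc j))) ℕ.+ inversions (τ ∘ suc)

  inversions-∘-adjacentSwap : (τ : Fin (suc n) → Fin m) (i : Fin n) → τ (suc i) < τ (inject₁ i) →
                              inversions τ ≡ suc (inversions (τ ∘ adjacentSwap i))
  inversions-∘-adjacentSwap {suc n} τ zero desc = begin
    (inverted τ₀ τ₁ ℕ.+ C₀) ℕ.+ (C₁ ℕ.+ I)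
      ≡⟨ cong (λ x → (x ℕ.+ C₀) ℕ.+ (C₁ ℕ.+ I)) (inverted-> desc) ⟩
    (1 ℕ.+ C₀) ℕ.+ (C₁ ℕ.+ I)
      ≡⟨ exchange C₀ C₁ I ⟩
    suc ((0 ℕ.+ C₁) ℕ.+ (C₀ ℕ.+ I))
      ≡⟨ cong (λ x → suc ((x ℕ.+ C₁) ℕ.+ (C₀ ℕ.+ I))) (inverted-< desc) ⟨
    suc ((inverted τ₁ τ₀ ℕ.+ C₁) ℕ.+ (C₀ ℕ.+ I)) ∎
    where
    τ₀ = τ zero
    τ₁ = τ (suc zero)
    C₀ = sumℕ {n} (λ k → inverted τ₀ (τ (suc (suc k))))
    C₁ = sumℕ {n} (λ k → inverted τ₁ (τ (suc (suc k))))
    I = inversions {n} (λ k → τ (suc (suc k)))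
    exchange : ∀ c₀ c₁ i → (1 ℕ.+ c₀) ℕ.+ (c₁ ℕ.+ i) ≡ suc ((0 ℕ.+ c₁) ℕ.+ (c₀ ℕ.+ i))
    exchange = ℕ-solve
  inversions-∘-adjacentSwap τ (suc i) desc = trans
    (cong₂ ℕ._+_ (sym (sumℕ-∘-adjacentSwap (λ j → inverted (τ zero) (τ (suc j))) i))
                 (inversions-∘-adjacentSwap (τ ∘ suc) i desc))
    (ℕₚ.+-suc _ _)

  -- Swapping an adjacent descent removes one inversion and flips both sides; a tie makes both sides 0;
  -- and an ascending τ is the identity.
  det-∘ : (A : Matrix n) (τ : Fin n → Fin n) → det (A ∘ τ) ≡ ε τ * det A
  det-∘ {zero}  A τ = refl
  det-∘ {suc n} A τ = sortRows τ (<-wellFounded (inversions τ))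
    where
    sortRows : (τ : Fin (suc n) → Fin (suc n)) → Acc ℕ._<_ (inversions τ) → det (A ∘ τ) ≡ ε τ * det A
    sortRows τ (acc smaller) with adjacent-trichotomy τ
    ... | inj₁ (i , desc) = begin
      det (A ∘ τ)                 ≡⟨ det-cong (λ k j → cong (λ l → A (τ l) j) (adjacentSwap-involutive i k)) ⟨
      det (A ∘ τ′ ∘ adjacentSwap i) ≡⟨ det-∘-adjacentSwap (A ∘ τ′) i ⟩
      - det (A ∘ τ′)              ≡⟨ cong -_ (sortRows τ′ (smaller fewer)) ⟩
      - (ε τ′ * det A)            ≡⟨ neg-distribˡ-* (ε τ′) (det A) ⟩
      - ε τ′ * det A              ≡⟨ cong (_* det A) ε-τ ⟨
      ε τ * det A                 ∎
      where
      τ′ = τ ∘ adjacentSwap i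
      fewer : inversions τ′ ℕ.< inversions τ
      fewer = ℕₚ.≤-reflexive (sym (inversions-∘-adjacentSwap τ i desc))
      ε-τ : ε τ ≡ - ε τ′
      ε-τ = trans (ε-cong (λ k → cong τ (sym (adjacentSwap-involutive i k)))) (ε-∘-adjacentSwap τ′ i)
    ... | inj₂ (inj₁ (i , tie)) = begin
      det (A ∘ τ)   ≡⟨ det-tie (A ∘ τ) i (λ j → cong (λ l → A l j) tie) ⟩
      0ℤ            ≡⟨ *-zeroˡ (det A) ⟨
      0ℤ * det A    ≡⟨ cong (_* det A) (ε-tie τ i tie) ⟨
      ε τ * det A   ∎
    ... | inj₂ (inj₂ asc) = begin
      det (A ∘ τ)   ≡⟨ det-cong (λ k j → cong (λ l → A l j) (ascending⇒≗id τ asc k)) ⟩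
      det A         ≡⟨ *-identityˡ (det A) ⟨
      1ℤ * det A    ≡⟨ cong (_* det A) (trans (ε-cong (ascending⇒≗id τ asc)) (ε-id {suc n})) ⟨
      ε τ * det A   ∎

  infixl 7 _·_
  infix 8 _ᵀ

  _·_ : Matrix n → Matrix n → Matrix n
  (A · B) i j = sum (λ k → A i k * B k j)

  _ᵀ : Matrix n → Matrix n
  (A ᵀ) i j = A j i

  det-· : (A B : Matrix n) → det (A · B) ≡ det A * det B
  det-· A B = begin
    sumMaps (λ σ → ε σ * ∏ (λ i → sum (λ k → A i k * B k (σ i))))
      ≡⟨ sumMaps-cong (λ σ → trans (cong (ε σ *_) (∏-sum≡sumMaps-∏ (λ i k → A i k * B k (σ i))))
                                   (*-distribˡ-sumMaps (ε σ) (λ τ → ∏ (λ i → A i (τ i) * B (τ i) (σ i))))) ⟩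
    sumMaps (λ σ → sumMaps (λ τ → ε σ * ∏ (λ i → A i (τ i) * B (τ i) (σ i))))
      ≡⟨ sumMaps-comm (λ σ τ → ε σ * ∏ (λ i → A i (τ i) * B (τ i) (σ i))) ⟩
    sumMaps (λ τ → sumMaps (λ σ → ε σ * ∏ (λ i → A i (τ i) * B (τ i) (σ i))))
      ≡⟨ sumMaps-cong (λ τ → trans (sumMaps-cong (factor τ))
                                   (sym (*-distribˡ-sumMaps (∏A τ) (leibnizTerm (B ∘ τ))))) ⟩
    sumMaps (λ τ → ∏A τ * det (B ∘ τ))
      ≡⟨ sumMaps-cong (λ τ → trans (cong (∏A τ *_) (det-∘ B τ)) (regroup (∏A τ) (ε τ) (det B))) ⟩
    sumMaps (λ τ → det B * leibnizTerm A τ)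
      ≡⟨ *-distribˡ-sumMaps (det B) (leibnizTerm A) ⟨
    det B * det A
      ≡⟨ *-comm (det B) (det A) ⟩
    det A * det B ∎
    where
    ∏A : (Fin _ → Fin _) → ℤ
    ∏A τ = ∏ (λ i → A i (τ i))
    factor : ∀ τ σ → ε σ * ∏ (λ i → A i (τ i) * B (τ i) (σ i)) ≡ ∏A τ * leibnizTerm (B ∘ τ) σ
    factor τ σ = trans (cong (ε σ *_) (∏-distrib-* (λ i → A i (τ i)) (λ i → B (τ i) (σ i))))
                       (x∙yz≈y∙xz (ε σ) (∏A τ) (∏ (λ i → B (τ i) (σ i))))
    regroup : ∀ a e d → a * (e * d) ≡ d * (e * a)
    regroup = solve-∀

  signedSquares : ℕ → ℤ
  signedSquares n = sumMaps {n} {n} (λ τ → ε τ * ε τ)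

  signedSquares≢0 : ∀ n → signedSquares n ≢ 0ℤ
  signedSquares≢0 n N≡0 with subst (1ℤ ≤_) N≡0 1≤N
    where
    1≤N : 1ℤ ≤ signedSquares n
    1≤N = subst (_≤ signedSquares n) (cong₂ _*_ (ε-id {n}) (ε-id {n}))
      (term≤sumMaps {n} {n} (λ τ → ε τ * ε τ) (λ σ≗τ → cong₂ _*_ (ε-cong σ≗τ) (ε-cong σ≗τ))
                    (λ τ → square-nonneg (ε τ)) id)
  ... | +≤+ ()

  doubleLeibniz : (A : Matrix n) →
                  sumMaps {n} (λ τ → sumMaps {n} (λ σ → ε τ * (ε σ * ∏ (λ i → A (τ i) (σ i)))))
                    ≡ signedSquares n * det A
  doubleLeibniz {n} A = begin
    sumMaps {n} (λ τ → sumMaps (λ σ → ε τ * leibnizTerm (A ∘ τ) σ))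
      ≡⟨ sumMaps-cong (λ τ → sym (*-distribˡ-sumMaps (ε τ) (leibnizTerm (A ∘ τ)))) ⟩
    sumMaps {n} (λ τ → ε τ * det (A ∘ τ))
      ≡⟨ sumMaps-cong (λ τ → trans (cong (ε τ *_) (det-∘ A τ)) (regroup (ε τ) (det A))) ⟩
    sumMaps {n} {n} (λ τ → det A * (ε τ * ε τ))
      ≡⟨ *-distribˡ-sumMaps {n} {n} (det A) (λ τ → ε τ * ε τ) ⟨
    det A * signedSquares n
      ≡⟨ *-comm (det A) (signedSquares n) ⟩
    signedSquares n * det A ∎
    where
    regroup : ∀ e d → e * (e * d) ≡ d * (e * e)
    regroup = solve-∀

  -- The double sum of doubleLeibniz is symmetric under A ↦ Aᵀ, and signedSquares n ≠ 0 can be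
  -- cancelled; this avoids inverting permutations.
  det-ᵀ : (A : Matrix n) → det (A ᵀ) ≡ det A
  det-ᵀ {n} A = *-cancelˡ-≡ (signedSquares n) (det (A ᵀ)) (det A) ⦃ ≢-nonZero (signedSquares≢0 n) ⦄
    (begin
    signedSquares n * det (A ᵀ)
      ≡⟨ doubleLeibniz (A ᵀ) ⟨
    sumMaps {n} (λ τ → sumMaps {n} (λ σ → ε τ * (ε σ * ∏ (λ i → A (σ i) (τ i)))))
      ≡⟨ sumMaps-cong {n} (λ τ → sumMaps-cong {n} (λ σ → x∙yz≈y∙xz (ε τ) (ε σ) _)) ⟩
    sumMaps {n} (λ τ → sumMaps {n} (λ σ → ε σ * (ε τ * ∏ (λ i → A (σ i) (τ i)))))
      ≡⟨ sumMaps-comm {n} {n} (λ τ σ → ε σ * (ε τ * ∏ (λ i → A (σ i) (τ i)))) ⟩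
    sumMaps {n} (λ σ → sumMaps {n} (λ τ → ε σ * (ε τ * ∏ (λ i → A (σ i) (τ i)))))
      ≡⟨ doubleLeibniz A ⟩
    signedSquares n * det A ∎)

  det-scalar : ∀ n (c : ℤ) → det {n} (λ i j → c * δ i j) ≡ c ^ n
  det-scalar n c = begin
    sumMaps {n} (λ σ → ε σ * ∏ (λ i → c * δ i (σ i)))
      ≡⟨ sumMaps-cong {n} (λ σ → trans (cong (ε σ *_) (∏-distrib-* {n} (λ _ → c) (λ i → δ i (σ i))))
                                   (sym (*-assoc (ε σ) (∏ {n} (λ _ → c)) (∏ (λ i → δ i (σ i)))))) ⟩
    sumMaps {n} (λ σ → (ε σ * ∏ {n} (λ _ → c)) * ∏ (λ i → δ i (σ i)))
      ≡⟨ sumMaps-δ {n} (λ σ → ε σ * ∏ {n} (λ _ → c)) (cong (_* ∏ {n} (λ _ → c)) ∘ ε-cong) id ⟩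
    ε {n} id * ∏ {n} (λ _ → c)
      ≡⟨ cong₂ _*_ (ε-id {n}) (∏-const n c) ⟩
    1ℤ * c ^ n
      ≡⟨ *-identityˡ (c ^ n) ⟩
    c ^ n ∎

  dot≡sum : (u w : ℤVec n) → dot u w ≡ sum (λ k → u k * w k)
  dot≡sum {zero}  u w = refl
  dot≡sum {suc n} u w = cong (u zero * w zero +_) (dot≡sum (u ∘ suc) (w ∘ suc))

  normSq-nonneg : (u : ℤVec n) → 0ℤ ≤ normSq u
  normSq-nonneg u = subst (0ℤ ≤_) (sym (dot≡sum u u)) (sum-nonneg _ (λ k → square-nonneg (u k)))

  orthoregular⇒gram : (v : Fin n → ℤVec n) → Orthoregular v →
                      ∀ l i j → (v · v ᵀ) i j ≡ normSq (v l) * δ i j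
  orthoregular⇒gram v (orthogonal , equalNorms , _) l i j with i Finₚ.≟ j
  ... | yes refl = begin
    sum (λ k → v i k * v i k)   ≡⟨ dot≡sum (v i) (v i) ⟨
    normSq (v i)                ≡⟨ equalNorms i l ⟩
    normSq (v l)                ≡⟨ *-identityʳ (normSq (v l)) ⟨
    normSq (v l) * 1ℤ           ≡⟨ cong (normSq (v l) *_) (δ-refl i) ⟨
    normSq (v l) * δ i i        ∎
  ... | no i≢j = begin
    sum (λ k → v i k * v j k)   ≡⟨ dot≡sum (v i) (v j) ⟨
    dot (v i) (v j)             ≡⟨ orthogonal i j i≢j ⟩
    0ℤ                          ≡⟨ *-zeroʳ (normSq (v l)) ⟨
    normSq (v l) * 0ℤ           ≡⟨ cong (normSq (v l) *_) (δ-≢ i j i≢j) ⟨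
    normSq (v l) * δ i j        ∎

  abs-^ : ∀ x n → ∣ x ^ n ∣ ≡ ∣ x ∣ ℕ.^ n
  abs-^ x zero    = refl
  abs-^ x (suc n) = trans (abs-* x (x ^ n)) (cong (∣ x ∣ ℕ.*_) (abs-^ x n))

  orthoregular⇒∣det∣²≡∣normSq∣^n : (v : Fin n → ℤVec n) → Orthoregular v →
                                   ∀ l → ∣ det v ∣ ℕ.* ∣ det v ∣ ≡ ∣ normSq (v l) ∣ ℕ.^ n
  orthoregular⇒∣det∣²≡∣normSq∣^n {n} v orthoregular l = begin
    ∣ det v ∣ ℕ.* ∣ det v ∣     ≡⟨ abs-* (det v) (det v) ⟨
    ∣ det v * det v ∣           ≡⟨ cong ∣_∣ det²≡normSq^n ⟩
    ∣ normSq (v l) ^ n ∣        ≡⟨ abs-^ (normSq (v l)) n ⟩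
    ∣ normSq (v l) ∣ ℕ.^ n      ∎
    where
    det²≡normSq^n : det v * det v ≡ normSq (v l) ^ n
    det²≡normSq^n = begin
      det v * det v                          ≡⟨ cong (det v *_) (det-ᵀ v) ⟨
      det v * det (v ᵀ)                      ≡⟨ det-· v (v ᵀ) ⟨
      det (v · v ᵀ)                          ≡⟨ det-cong (orthoregular⇒gram v orthoregular l) ⟩
      det {n} (λ i j → normSq (v l) * δ i j) ≡⟨ det-scalar n (normSq (v l)) ⟩
      normSq (v l) ^ n                       ∎

open Determinants using (det; normSq-nonneg; orthoregular⇒∣det∣²≡∣normSq∣^n)

open import Data.Nat using (ℕ; zero; suc; _+_; _*_; _^_; NonZero; ≢-nonZero)
open import Data.Nat.Properties
  using (*-cancelʳ-≡; m*n≡0⇒m≡0∨n≡0; m*n≢0; m^n≢0; ^-distribˡ-+-*; +-identityʳ; *-identityˡ)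
open import Data.Nat.Tactic.RingSolver using (solve-∀)
open import Data.Nat.Divisibility using (_∣_; divides; ∣-refl; ∣-trans; m∣m*n; 0∣⇒≡0; *-cancelʳ-∣)
open import Data.Nat.DivMod using (_/_; m/n*n≡m)
open import Data.Nat.GCD using (gcd; gcd[m,n]∣m; gcd[m,n]∣n; gcd[m,n]≢0)
open import Data.Nat.Coprimality using (Coprime; coprime-/gcd; coprime-divisor)
open import Data.Integer using (+_; ∣_∣)
open import Data.Integer.Properties using (0≤i⇒+∣i∣≡i)
open import Data.Fin using (Fin; zero)
open import Data.Product using (Σ; _,_; proj₁; proj₂)
open import Data.Sum using (inj₁; inj₂)
open import Relation.Binary.PropositionalEquality
open ≡-Reasoning

-- Odd powers that are squares

[xy]²≡x²y² : ∀ x y → (x * y) * (x * y) ≡ (x * x) * (y * y)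
[xy]²≡x²y² = solve-∀

m*m∣n*n⇒m∣n : ∀ m n → m * m ∣ n * n → m ∣ n
m*m∣n*n⇒m∣n zero n 0∣n*n with m*n≡0⇒m≡0∨n≡0 n (0∣⇒≡0 0∣n*n)
... | inj₁ refl = ∣-refl
... | inj₂ refl = ∣-refl
m*m∣n*n⇒m∣n m@(suc _) n m*m∣n*n = subst (_∣ n) g≡m (gcd[m,n]∣n m n)
  where
  g = gcd m n
  instance
    g≢0 : NonZero g
    g≢0 = ≢-nonZero (gcd[m,n]≢0 m n (inj₁ λ ()))
    g*g≢0 : NonZero (g * g)
    g*g≢0 = m*n≢0 g g
  m′ = m / g
  n′ = n / g
  m′*g≡m : m′ * g ≡ m
  m′*g≡m = m/n*n≡m (gcd[m,n]∣m m n)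
  n′*g≡n : n′ * g ≡ n
  n′*g≡n = m/n*n≡m (gcd[m,n]∣n m n)
  m′*m′∣n′*n′ : m′ * m′ ∣ n′ * n′
  m′*m′∣n′*n′ = *-cancelʳ-∣ (g * g) (subst₂ _∣_
    (trans (cong (λ x → x * x) (sym m′*g≡m)) ([xy]²≡x²y² m′ g))
    (trans (cong (λ x → x * x) (sym n′*g≡n)) ([xy]²≡x²y² n′ g))
    m*m∣n*n)
  coprime : Coprime m′ n′
  coprime = coprime-/gcd m n
  m′≡1 : m′ ≡ 1
  m′≡1 = coprime (∣-refl , coprime-divisor coprime (∣-trans (m∣m*n m′) m′*m′∣n′*n′))
  g≡m : g ≡ m
  g≡m = trans (sym (*-identityˡ g)) (trans (cong (_* g) (sym m′≡1)) m′*g≡m)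

odd-power-square⇒square : ∀ a k d → d * d ≡ a ^ suc (2 * k) → Σ ℕ λ m → a ≡ m * m
odd-power-square⇒square zero      k d _ = 0 , refl
odd-power-square⇒square a@(suc _) k d d*d≡a^[1+2k] = q , *-cancelʳ-≡ a (q * q) (x * x) (begin
  a * (x * x)          ≡⟨ d*d≡a*[x*x] ⟨
  d * d                ≡⟨ cong (λ y → y * y) d≡q*x ⟩
  (q * x) * (q * x)    ≡⟨ [xy]²≡x²y² q x ⟩
  (q * q) * (x * x)    ∎)
  where
  x = a ^ k
  instance
    x*x≢0 : NonZero (x * x)
    x*x≢0 = m*n≢0 x x ⦃ m^n≢0 a k ⦄ ⦃ m^n≢0 a k ⦄
  d*d≡a*[x*x] : d * d ≡ a * (x * x)
  d*d≡a*[x*x] = trans d*d≡a^[1+2k]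
    (cong (a *_) (trans (^-distribˡ-+-* a k (k + 0)) (cong (λ j → x * a ^ j) (+-identityʳ k))))
  open _∣_ (m*m∣n*n⇒m∣n x d (divides a d*d≡a*[x*x])) renaming (quotient to q; equality to d≡q*x)

mainTheorem1 : (n k : ℕ) → n ≡ suc (2 * k) → (v : Fin n → ℤVec n) → Orthoregular v →
    Σ ℕ (λ m → (i : Fin n) → normSq (v i) ≡ + (m * m))
mainTheorem1 .(suc (2 * k)) k refl v orthoregular@(_ , equalNorms , _) = m , λ i → begin
  normSq (v i)             ≡⟨ equalNorms i zero ⟩
  normSq (v zero)          ≡⟨ 0≤i⇒+∣i∣≡i (normSq-nonneg (v zero)) ⟨
  + ∣ normSq (v zero) ∣    ≡⟨ cong +_ ∣normSq∣≡m*m ⟩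
  + (m * m)                ∎
  where
  square : Σ ℕ λ m → ∣ normSq (v zero) ∣ ≡ m * m
  square = odd-power-square⇒square _ k ∣ det v ∣ (orthoregular⇒∣det∣²≡∣normSq∣^n v orthoregular zero)
  m = proj₁ square
  ∣normSq∣≡m*m = proj₂ square
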